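{- Let $f$ be a non-commutative polynomial that is abecedarian with respect to a bucketing system of size $m$, and let $\mathcal{C}$ be a circuit of size $s$ computing $f$. Then there is an abecedarian circuit $\mathcal{C}'$ (with respect to the same bucketing system) computing $f$ of size $O(m^3 s)$.
   Context: Circuits are non-commutative algebraic circuits (products taken in a fixed order of children). A bucketing system of size $m$ is an ordered partition $(X_1,\dots,X_m)$ of the variable set. A polynomial $f$ is abecedarian with respect to it if every monomial $y_1\cdots y_k$ ($k\ge1$) with nonzero coefficient satisfies $y_j\in X_{i_j}$ with $i_1\le\cdots\le i_k$. For a polynomial $g$ and $1\le a\le b\le m+1$, $g[a,b)$ is the constant term of $g$ if $a=b$, and if $a<b$ the sum of all terms $c\,y_1\cdots y_k$ ($k\ge1$) of $g$ with $y_j\in X_{i_j}$ and $a=i_1\le\cdots\le i_k<b$. An abecedarian circuit is a circuit, possibly with several output gates, in which every gate $v$ carries a label $I_v=[a,b)$ with $1\le a\le b\le m+1$ such that the polynomial $f_v$ computed at $v$ satisfies $f_v=f_v[a,b)$; if $v$ is a sum gate its children carry the same label as $v$; if $v=v_1\times v_2$ with $I_v=[a,a)$ then $I_{v_1}=I_{v_2}=[a,a)$; if $v=v_1\times v_2$ with $I_v=[a,b)$, $a<b$, then $(I_{v_1},I_{v_2})$ is $([a,b),[b,b))$, $([a,a),[a,b))$, or $([a,c+1),[c,b))$ for some $a\le c<b$. The polynomial computed is the sum of the polynomials at the output gates. -}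

module Defs where

open import Level using (Level; _⊔_) renaming (suc to lsuc)
open import Algebra.Bundles using (CommutativeRing)
open import Data.Nat.Base using (ℕ; zero; suc; _≡ᵇ_; _<ᵇ_; _≤ᵇ_)
open import Data.Fin.Base as Fin using (Fin; toℕ)
import Data.Nat.Base
import Data.Unit.Base
open import Data.List.Base using (List; []; _∷_)
open import Data.Bool.Base using (Bool; true; false; _∧_; if_then_else_)
open import Data.Product.Base using (Σ; ∃; _×_; _,_)
open import Data.Sum.Base using (_⊎_)
open import Relation.Nullary using (¬_)
open import Relation.Binary.PropositionalEquality using (_≡_)

record Field (c ℓ : Level) : Set (lsuc (c ⊔ ℓ)) where
  field
    commutativeRing : CommutativeRing c ℓ
  open CommutativeRing commutativeRing public
  field
    1≉0     : ¬ (1# ≈ 0#)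
    inverse : ∀ x → ¬ (x ≈ 0#) → ∃ λ y → (x * y) ≈ 1#

-- Buckets, with 0-based indexing: a bucketing system of size m on the
-- variables Fin n is a map β : Fin n → Fin m  (X_i = β⁻¹(i)).
-- Paper's interval [a,b) with 1 ≤ a ≤ b ≤ m+1 becomes [a-1,b-1),
-- i.e. 0 ≤ a ≤ b ≤ m here.

module Buckets {n m : ℕ} (β : Fin n → Fin m) where

  bkt : Fin n → ℕ
  bkt y = toℕ (β y)

  sortedFrom : ℕ → List (Fin n) → Bool
  sortedFrom i []       = true
  sortedFrom i (y ∷ ys) = (i ≤ᵇ bkt y) ∧ sortedFrom (bkt y) ys

  allBelow : ℕ → List (Fin n) → Bool
  allBelow b []       = true
  allBelow b (y ∷ ys) = (bkt y <ᵇ b) ∧ allBelow b ys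

  -- inRange a b w : the monomial w is kept by the operator g ↦ g[a,b)
  --   a = b : w is the empty word (constant term)
  --   a < b : w = y1…yk, k ≥ 1, buckets a = i1 ≤ … ≤ ik < b
  inRange : ℕ → ℕ → List (Fin n) → Bool
  inRange a b [] = a ≡ᵇ b
  inRange a b (y ∷ ys) =
    (a <ᵇ b) ∧ ((bkt y ≡ᵇ a) ∧ (sortedFrom (bkt y) ys ∧ allBelow b (y ∷ ys)))

module NC {c ℓ : Level} (F : Field c ℓ) where
  open Field F

  Poly : ℕ → Set c
  Poly n = List (Fin n) → Carrier

  _≋_ : {n : ℕ} → Poly n → Poly n → Set ℓ
  f ≋ g = ∀ w → f w ≈ g w

  zeroP : {n : ℕ} → Poly n
  zeroP w = 0#

  constP : {n : ℕ} → Carrier → Poly n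
  constP k []      = k
  constP k (_ ∷ _) = 0#

  varP : {n : ℕ} → Fin n → Poly n
  varP x []            = 0#
  varP x (y ∷ [])      = if toℕ x ≡ᵇ toℕ y then 1# else 0#
  varP x (y ∷ _ ∷ _)   = 0#

  addP : {n : ℕ} → Poly n → Poly n → Poly n
  addP f g w = f w + g w

  -- non-commutative product: (f·g)(w) = Σ_{w = u v} f(u) g(v)
  mulP : {n : ℕ} → Poly n → Poly n → Poly n
  mulP f g []       = f [] * g []
  mulP f g (x ∷ w)  = (f [] * g (x ∷ w)) + mulP (λ u → f (x ∷ u)) g w

  -- A gate whose children are among k previously built gates.
  data Gate (n k : ℕ) : Set c where
    var   : Fin n → Gate n k
    const : Carrier → Gate n k
    add   : Fin k → Fin k → Gate n k
    mul   : Fin k → Fin k → Gate n k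

  -- A circuit with s gates (size s) in variables Fin n: a straight-line
  -- program; gate 'zero' is the newest, whose children are among the
  -- remaining gates.  This represents sharing (DAG), not formulas.
  data Circuit (n : ℕ) : ℕ → Set c where
    []  : Circuit n 0
    _∷_ : {k : ℕ} → Gate n k → Circuit n k → Circuit n (suc k)

  gateP : {n k : ℕ} → Gate n k → (Fin k → Poly n) → Poly n
  gateP (var x)   ev = varP x
  gateP (const a) ev = constP a
  gateP (add i j) ev = addP (ev i) (ev j)
  gateP (mul i j) ev = mulP (ev i) (ev j)

  eval : {n s : ℕ} → Circuit n s → Fin s → Poly n
  eval (g ∷ C) Fin.zero    = gateP g (eval C)
  eval (g ∷ C) (Fin.suc i) = eval C i

  gateAt : {n s : ℕ} → Circuit n s → Fin s → Σ ℕ (λ k → Gate n k × (Fin k → Fin s))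
  gateAt (g ∷ C) Fin.zero    = _ , g , Fin.suc
  gateAt (g ∷ C) (Fin.suc i) with gateAt C i
  ... | k , g′ , emb = k , g′ , (λ j → Fin.suc (emb j))

  Computes : {n s : ℕ} → Circuit n s → Fin s → Poly n → Set ℓ
  Computes C o f = eval C o ≋ f

  sumOutputs : {n s : ℕ} → Circuit n s → List (Fin s) → Poly n
  sumOutputs C []       = zeroP
  sumOutputs C (o ∷ os) = addP (eval C o) (sumOutputs C os)

  module _ {n m : ℕ} (β : Fin n → Fin m) where
    open Buckets β

    restrict : ℕ → ℕ → Poly n → Poly n
    restrict a b g w = if inRange a b w then g w else 0#

    Abecedarian : Poly n → Set ℓ
    Abecedarian f = ∀ y ys → sortedFrom 0 (y ∷ ys) ≡ false → f (y ∷ ys) ≈ 0#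

    Label : Set
    Label = ℕ × ℕ

    ValidLabel : Label → Set
    ValidLabel (a , b) = (a Data.Nat.Base.≤ b) × (b Data.Nat.Base.≤ m)

    MulLabels : Label → Label → Label → Set
    MulLabels (a , b) l₁ l₂ =
        (a ≡ b × l₁ ≡ (a , a) × l₂ ≡ (a , a))
      ⊎ (a Data.Nat.Base.< b ×
          ( (l₁ ≡ (a , b) × l₂ ≡ (b , b))
          ⊎ (l₁ ≡ (a , a) × l₂ ≡ (a , b))
          ⊎ (∃ λ c′ → a Data.Nat.Base.≤ c′ × c′ Data.Nat.Base.< b
                      × l₁ ≡ (a , suc c′) × l₂ ≡ (c′ , b))))

    GateOK : {k s : ℕ} → (Fin s → Label) → Label → Gate n k → (Fin k → Fin s) → Set
    GateOK lab l (var x)   emb = Data.Unit.Base.⊤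
    GateOK lab l (const x) emb = Data.Unit.Base.⊤
    GateOK lab l (add i j) emb = lab (emb i) ≡ l × lab (emb j) ≡ l
    GateOK lab l (mul i j) emb = MulLabels l (lab (emb i)) (lab (emb j))

    IsAbecedarian : {s : ℕ} → Circuit n s → (Fin s → Label) → Set ℓ
    IsAbecedarian {s} C lab = ∀ (v : Fin s) →
        ValidLabel (lab v)
      × (eval C v ≋ restrict (proj₁′ (lab v)) (proj₂′ (lab v)) (eval C v))
      × GateOKAt v
      where
        proj₁′ : Label → ℕ
        proj₁′ (a , _) = a
        proj₂′ : Label → ℕ
        proj₂′ (_ , b) = b
        GateOKAt : Fin s → Set
        GateOKAt v with gateAt C v
        ... | k , g , emb = GateOK lab (lab v) g emb

module Submission where

-- The new circuit has, for every gate v of C and every interval [a,b), a gate computing f_v[a,b).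
-- Restriction commutes with sums, and for products
--   (gh)[a,a) = g[a,a) h[a,a),
--   (gh)[a,b) = g[a,b) h[b,b) + g[a,a) h[a,b) + Σ_{a ≤ c < b} g[a,c+1) h[c,b)     (a < b),
-- according to whether a monomial of (gh)[a,b) is cut as u·v with v empty, with u empty, or with v
-- starting in bucket c.  So each pair (v, [a,b)) costs O(m) gates, O(m³ s) in all, and an abecedarian
-- f is recovered as the sum of the outputs f_o[a,m), 0 ≤ a ≤ m (buckets are numbered from 0).

open import Level using (Level; _⊔_)
open import Defs
open import Data.Nat.Base using (ℕ; zero; suc; _+_; _*_; _^_; _∸_; _≤_; _<_; z≤n; s≤s; _≡ᵇ_; _<ᵇ_; _≤ᵇ_)
import Data.Nat.Properties as ℕₚ
open import Data.Nat.Tactic.RingSolver using (solve-∀)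
open import Data.Fin.Base using (Fin; toℕ) renaming (zero to fzero; suc to fsuc)
open import Data.Fin.Properties using (toℕ<n; toℕ-injective)
open import Data.Bool.Base using (Bool; true; false; _∧_; if_then_else_; T)
open import Data.Bool.Properties using (T-∧)
open import Data.List.Base using (List; []; _∷_; _++_)
open import Data.List.Properties using (++-identityʳ; ++-conicalˡ; ++-conicalʳ)
open import Data.Product.Base using (Σ; _×_; _,_; proj₁; proj₂)
open import Data.Sum.Base using (inj₁; inj₂)
open import Data.Empty using (⊥; ⊥-elim)
open import Data.Unit.Base using (tt)
import Data.Vec.Functional as VF
open import Function.Base using (id; _∘′_)
open import Function.Bundles using (Equivalence)
open import Relation.Nullary using (¬_; yes; no)
open import Relation.Nullary.Decidable using (T?)
open import Relation.Binary.PropositionalEquality using (_≡_; _≢_; refl; sym; cong; subst; subst₂)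
  renaming (trans to ≡-trans)

T-∧⁺ : ∀ x {y} → T x → T y → T (x ∧ y)
T-∧⁺ x p q = Equivalence.from (T-∧ {x}) (p , q)

T-∧⁻ : ∀ x {y} → T (x ∧ y) → T x × T y
T-∧⁻ x = Equivalence.to (T-∧ {x})

¬T⇒≡false : ∀ {b} → ¬ T b → b ≡ false
¬T⇒≡false {true}  ¬b = ⊥-elim (¬b tt)
¬T⇒≡false {false} _  = refl

module BucketWords {n m : ℕ} (β : Fin n → Fin m) where
  open Buckets β

  sortedFrom-∷⁻ : ∀ i z u → T (sortedFrom i (z ∷ u)) → i ≤ bkt z × T (sortedFrom (bkt z) u)
  sortedFrom-∷⁻ i z u p with T-∧⁻ (i ≤ᵇ bkt z) p
  ... | i≤z , u-sorted = ℕₚ.≤ᵇ⇒≤ i (bkt z) i≤z , u-sorted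

  sortedFrom-∷⁺ : ∀ i z u → i ≤ bkt z → T (sortedFrom (bkt z) u) → T (sortedFrom i (z ∷ u))
  sortedFrom-∷⁺ i z u i≤z u-sorted = T-∧⁺ (i ≤ᵇ bkt z) (ℕₚ.≤⇒≤ᵇ i≤z) u-sorted

  allBelow-∷⁻ : ∀ {k} z u → T (allBelow k (z ∷ u)) → bkt z < k × T (allBelow k u)
  allBelow-∷⁻ {k} z u p with T-∧⁻ (bkt z <ᵇ k) p
  ... | z<k , u-below = ℕₚ.<ᵇ⇒< (bkt z) k z<k , u-below

  allBelow-∷⁺ : ∀ {k} z u → bkt z < k → T (allBelow k u) → T (allBelow k (z ∷ u))
  allBelow-∷⁺ {k} z u z<k u-below = T-∧⁺ (bkt z <ᵇ k) (ℕₚ.<⇒<ᵇ z<k) u-below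

  record InRange∷ (a b : ℕ) (y : Fin n) (ys : List (Fin n)) : Set where
    field
      lower<upper : a < b
      head≡lower  : bkt y ≡ a
      tail-sorted : T (sortedFrom (bkt y) ys)
      tail-below  : T (allBelow b ys)

  open InRange∷ public

  inRange-∷⁻ : ∀ {a b} y ys → T (inRange a b (y ∷ ys)) → InRange∷ a b y ys
  inRange-∷⁻ {a} {b} y ys p
    with T-∧⁻ (a <ᵇ b) p
  ... | a<b , q with T-∧⁻ (bkt y ≡ᵇ a) q
  ... | y∈a , r with T-∧⁻ (sortedFrom (bkt y) ys) r
  ... | ys-sorted , y∷ys-below = record
    { lower<upper = ℕₚ.<ᵇ⇒< a b a<b
    ; head≡lower  = ℕₚ.≡ᵇ⇒≡ (bkt y) a y∈a
    ; tail-sorted = ys-sorted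
    ; tail-below  = proj₂ (allBelow-∷⁻ y ys y∷ys-below)
    }

  inRange-∷⁺ : ∀ {a b} y ys → a < b → bkt y ≡ a → T (sortedFrom (bkt y) ys) → T (allBelow b ys) →
               T (inRange a b (y ∷ ys))
  inRange-∷⁺ {a} {b} y ys a<b y∈a ys-sorted ys-below =
    T-∧⁺ (a <ᵇ b) (ℕₚ.<⇒<ᵇ a<b) (T-∧⁺ (bkt y ≡ᵇ a) (ℕₚ.≡⇒≡ᵇ (bkt y) a y∈a)
      (T-∧⁺ (sortedFrom (bkt y) ys) ys-sorted
        (allBelow-∷⁺ y ys (subst (_< b) (sym y∈a) a<b) ys-below)))

  inRange-[]⁺ : ∀ a → T (inRange a a [])
  inRange-[]⁺ a = ℕₚ.≡⇒≡ᵇ a a refl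

  inRange-[]⁻ : ∀ {a b} → T (inRange a b []) → a ≡ b
  inRange-[]⁻ {a} {b} = ℕₚ.≡ᵇ⇒≡ a b

  ¬inRange-[] : ∀ {a b} → a < b → ¬ T (inRange a b [])
  ¬inRange-[] a<b p = ℕₚ.<⇒≢ a<b (inRange-[]⁻ p)

  inRange-∷-empty : ∀ a y ys → ¬ T (inRange a a (y ∷ ys))
  inRange-∷-empty a y ys p = ℕₚ.<-irrefl refl (lower<upper (inRange-∷⁻ {a} {a} y ys p))

  inRange-empty : ∀ a w → T (inRange a a w) → w ≡ []
  inRange-empty a []       _ = refl
  inRange-empty a (y ∷ ys) p = ⊥-elim (inRange-∷-empty a y ys p)

  inRange-++-empty⁻ : ∀ a u v → T (inRange a a (u ++ v)) → T (inRange a a u) × T (inRange a a v)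
  inRange-++-empty⁻ a u v p with ++-conicalˡ u v (inRange-empty a (u ++ v) p) | ++-conicalʳ u v (inRange-empty a (u ++ v) p)
  ... | refl | refl = inRange-[]⁺ a , inRange-[]⁺ a

  lastBucket : ℕ → List (Fin n) → ℕ
  lastBucket i []       = i
  lastBucket i (z ∷ zs) = lastBucket (bkt z) zs

  sortedFrom-++⁻ : ∀ i u y v → T (sortedFrom i (u ++ y ∷ v)) →
                   T (sortedFrom i u) × lastBucket i u ≤ bkt y × T (sortedFrom (bkt y) v)
  sortedFrom-++⁻ i []      y v p = tt , sortedFrom-∷⁻ i y v p
  sortedFrom-++⁻ i (z ∷ u) y v p with sortedFrom-∷⁻ i z (u ++ y ∷ v) p
  ... | i≤z , rest with sortedFrom-++⁻ (bkt z) u y v rest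
  ... | u-sorted , last≤y , v-sorted = sortedFrom-∷⁺ i z u i≤z u-sorted , last≤y , v-sorted

  sortedFrom-++⁺ : ∀ i u y v → T (sortedFrom i u) → lastBucket i u ≤ bkt y → T (sortedFrom (bkt y) v) →
                   T (sortedFrom i (u ++ y ∷ v))
  sortedFrom-++⁺ i []      y v _ last≤y v-sorted = sortedFrom-∷⁺ i y v last≤y v-sorted
  sortedFrom-++⁺ i (z ∷ u) y v p last≤y v-sorted with sortedFrom-∷⁻ i z u p
  ... | i≤z , u-sorted = sortedFrom-∷⁺ i z (u ++ y ∷ v) i≤z (sortedFrom-++⁺ (bkt z) u y v u-sorted last≤y v-sorted)

  allBelow-++⁻ : ∀ k u v → T (allBelow k (u ++ v)) → T (allBelow k u) × T (allBelow k v)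
  allBelow-++⁻ k []      v p = tt , p
  allBelow-++⁻ k (z ∷ u) v p with allBelow-∷⁻ z (u ++ v) p
  ... | z<k , rest with allBelow-++⁻ k u v rest
  ... | u-below , v-below = allBelow-∷⁺ z u z<k u-below , v-below

  allBelow-++⁺ : ∀ k u v → T (allBelow k u) → T (allBelow k v) → T (allBelow k (u ++ v))
  allBelow-++⁺ k []      v _ q = q
  allBelow-++⁺ k (z ∷ u) v p q with allBelow-∷⁻ z u p
  ... | z<k , u-below = allBelow-∷⁺ z (u ++ v) z<k (allBelow-++⁺ k u v u-below q)

  allBelow-mono : ∀ {k k′} u → k ≤ k′ → T (allBelow k u) → T (allBelow k′ u)
  allBelow-mono []      _    _ = tt
  allBelow-mono (z ∷ u) k≤k′ p with allBelow-∷⁻ z u p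
  ... | z<k , u-below = allBelow-∷⁺ z u (ℕₚ.<-≤-trans z<k k≤k′) (allBelow-mono u k≤k′ u-below)

  allBelow-bucketCount : ∀ u → T (allBelow m u)
  allBelow-bucketCount []      = tt
  allBelow-bucketCount (z ∷ u) = allBelow-∷⁺ z u (toℕ<n (β z)) (allBelow-bucketCount u)

  sortedFrom⇒≤lastBucket : ∀ i u → T (sortedFrom i u) → i ≤ lastBucket i u
  sortedFrom⇒≤lastBucket i []      _ = ℕₚ.≤-refl
  sortedFrom⇒≤lastBucket i (z ∷ u) p with sortedFrom-∷⁻ i z u p
  ... | i≤z , u-sorted = ℕₚ.≤-trans i≤z (sortedFrom⇒≤lastBucket (bkt z) u u-sorted)

  sortedFrom⇒allBelow : ∀ i u k → T (sortedFrom i u) → lastBucket i u < k → T (allBelow k u)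
  sortedFrom⇒allBelow i []      k _ _      = tt
  sortedFrom⇒allBelow i (z ∷ u) k p last<k with sortedFrom-∷⁻ i z u p
  ... | _ , u-sorted =
    allBelow-∷⁺ z u (ℕₚ.≤-<-trans (sortedFrom⇒≤lastBucket (bkt z) u u-sorted) last<k)
      (sortedFrom⇒allBelow (bkt z) u k u-sorted last<k)

  allBelow⇒lastBucket< : ∀ i u k → T (sortedFrom i u) → T (allBelow k u) → i < k → lastBucket i u < k
  allBelow⇒lastBucket< i []      k _ _ i<k = i<k
  allBelow⇒lastBucket< i (z ∷ u) k p q _ with sortedFrom-∷⁻ i z u p | allBelow-∷⁻ z u q
  ... | _ , u-sorted | z<k , u-below = allBelow⇒lastBucket< (bkt z) u k u-sorted u-below z<k

  inRange-++⁺ : ∀ a b c x u y v → T (inRange a (suc c) (x ∷ u)) → T (inRange c b (y ∷ v)) →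
                T (inRange a b (x ∷ u ++ y ∷ v))
  inRange-++⁺ a b c x u y v p q =
    inRange-∷⁺ x (u ++ y ∷ v) a<b (head≡lower xu)
      (sortedFrom-++⁺ (bkt x) u y v (tail-sorted xu) last≤y (tail-sorted yv))
      (allBelow-++⁺ b u (y ∷ v) (allBelow-mono u (lower<upper yv) (tail-below xu))
        (allBelow-∷⁺ y v (subst (_< b) (sym (head≡lower yv)) (lower<upper yv)) (tail-below yv)))
    where
      xu : InRange∷ a (suc c) x u
      xu = inRange-∷⁻ x u p
      yv : InRange∷ c b y v
      yv = inRange-∷⁻ y v q
      a<b : a < b
      a<b = ℕₚ.≤-<-trans (ℕₚ.m<1+n⇒m≤n (lower<upper xu)) (lower<upper yv)
      last≤y : lastBucket (bkt x) u ≤ bkt y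
      last≤y = subst (lastBucket (bkt x) u ≤_) (sym (head≡lower yv))
        (ℕₚ.m<1+n⇒m≤n (allBelow⇒lastBucket< (bkt x) u (suc c) (tail-sorted xu) (tail-below xu)
          (subst (_< suc c) (sym (head≡lower xu)) (lower<upper xu))))

  inRange-++⁻ : ∀ a b x u y v → T (inRange a b (x ∷ u ++ y ∷ v)) →
                T (inRange a (suc (bkt y)) (x ∷ u)) × T (inRange (bkt y) b (y ∷ v))
  inRange-++⁻ a b x u y v p = split (inRange-∷⁻ x (u ++ y ∷ v) p)
    where
      split : InRange∷ a b x (u ++ y ∷ v) → T (inRange a (suc (bkt y)) (x ∷ u)) × T (inRange (bkt y) b (y ∷ v))
      split xuyv with sortedFrom-++⁻ (bkt x) u y v (tail-sorted xuyv) | allBelow-++⁻ b u (y ∷ v) (tail-below xuyv)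
      ... | u-sorted , last≤y , v-sorted | _ , yv-below with allBelow-∷⁻ y v yv-below
      ... | y<b , v-below =
        inRange-∷⁺ x u (s≤s (subst (_≤ bkt y) (head≡lower xuyv) x≤y)) (head≡lower xuyv) u-sorted
          (sortedFrom⇒allBelow (bkt x) u (suc (bkt y)) u-sorted (s≤s last≤y)) ,
        inRange-∷⁺ y v y<b refl v-sorted v-below
        where
          x≤y : bkt x ≤ bkt y
          x≤y = ℕₚ.≤-trans (sortedFrom⇒≤lastBucket (bkt x) u u-sorted) last≤y

-- A sum of t cut products takes t products, t additions and a zero gate; a restricted product adds
-- the two products with an empty side and two more additions.
cutCost : ℕ → ℕ
cutCost t = t * 2 + 1

cutCost-mono : ∀ {t u} → t ≤ u → cutCost t ≤ cutCost u
cutCost-mono t≤u = ℕₚ.+-monoˡ-≤ 1 (ℕₚ.*-monoˡ-≤ 2 t≤u)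

pairCost : ℕ → ℕ
pairCost m = 4 + cutCost m

gateCost : ℕ → ℕ
gateCost m = suc m * (suc m * pairCost m)

gateCost-expansion : ∀ x → (2 + x) * ((2 + x) * (4 + ((1 + x) * 2 + 1))) + x * (26 * x * x + 69 * x + 48)
                           ≡ 28 * ((1 + x) * ((1 + x) * ((1 + x) * 1)))
gateCost-expansion = solve-∀

gateCost-bound : ∀ {m} → 1 ≤ m → gateCost m ≤ 28 * m ^ 3
gateCost-bound {suc x} _ = subst (gateCost (suc x) ≤_) (gateCost-expansion x) (ℕₚ.m≤m+n (gateCost (suc x)) _)

module _ {c ℓ : Level} (F : Field c ℓ) where
  open Field F hiding (zero)
    renaming (_+_ to _⊕_; _*_ to _⊗_; refl to ≈-refl; sym to ≈-sym; trans to ≈-trans)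
  open NC F
  open import Relation.Binary.Reasoning.Setoid setoid
  open import Algebra.Properties.CommutativeSemigroup +-commutativeSemigroup using (interchange)

  ⊕-≈0 : ∀ {x y} → x ≈ 0# → y ≈ 0# → x ⊕ y ≈ 0#
  ⊕-≈0 x≈0 y≈0 = ≈-trans (+-cong x≈0 y≈0) (+-identityˡ 0#)

  ⊕₃-only₁ : ∀ {x y z r} → x ≈ r → y ≈ 0# → z ≈ 0# → (x ⊕ y) ⊕ z ≈ r
  ⊕₃-only₁ x≈r y≈0 z≈0 = ≈-trans (+-cong (≈-trans (+-cong x≈r y≈0) (+-identityʳ _)) z≈0) (+-identityʳ _)

  ⊕₃-only₂ : ∀ {x y z r} → x ≈ 0# → y ≈ r → z ≈ 0# → (x ⊕ y) ⊕ z ≈ r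
  ⊕₃-only₂ x≈0 y≈r z≈0 = ≈-trans (+-cong (≈-trans (+-cong x≈0 y≈r) (+-identityˡ _)) z≈0) (+-identityʳ _)

  ⊕₃-only₃ : ∀ {x y z r} → x ≈ 0# → y ≈ 0# → z ≈ r → (x ⊕ y) ⊕ z ≈ r
  ⊕₃-only₃ x≈0 y≈0 z≈r = ≈-trans (+-cong (⊕-≈0 x≈0 y≈0) z≈r) (+-identityˡ _)

  keepIf : Bool → Carrier → Carrier
  keepIf b x = if b then x else 0#

  keepIf-false : ∀ b x → ¬ T b → keepIf b x ≈ 0#
  keepIf-false true  x ¬b = ⊥-elim (¬b tt)
  keepIf-false false x _  = ≈-refl

  keepIf-true : ∀ b x → T b → keepIf b x ≈ x
  keepIf-true true x _ = ≈-refl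

  keepIf-0# : ∀ b → keepIf b 0# ≈ 0#
  keepIf-0# true  = ≈-refl
  keepIf-0# false = ≈-refl

  keepIf-cong : ∀ b {x y} → x ≈ y → keepIf b x ≈ keepIf b y
  keepIf-cong true  x≈y = x≈y
  keepIf-cong false _   = ≈-refl

  keepIf-absorbs : ∀ b x → (¬ T b → x ≈ 0#) → x ≈ keepIf b x
  keepIf-absorbs true  x _    = ≈-refl
  keepIf-absorbs false x x≈0 = x≈0 (λ ())

  keepIf-⊕ : ∀ b x y → keepIf b (x ⊕ y) ≈ keepIf b x ⊕ keepIf b y
  keepIf-⊕ true  x y = ≈-refl
  keepIf-⊕ false x y = ≈-sym (+-identityˡ 0#)

  keepIf-⊗ : ∀ b b₁ b₂ x y → (T b → T b₁ × T b₂) → (T b₁ → T b₂ → T b) →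
             keepIf b₁ x ⊗ keepIf b₂ y ≈ keepIf b (x ⊗ y)
  keepIf-⊗ b true  true  x y _ both = ≈-sym (keepIf-true b _ (both tt tt))
  keepIf-⊗ b false b₂    x y only _ = ≈-trans (zeroˡ _) (≈-sym (keepIf-false b _ (λ t → proj₁ (only t))))
  keepIf-⊗ b true  false x y only _ = ≈-trans (zeroʳ _) (≈-sym (keepIf-false b _ (λ t → proj₂ (only t))))

  keepIf-⊗-disjoint : ∀ b₁ b₂ x y → (T b₁ → T b₂ → ⊥) → keepIf b₁ x ⊗ keepIf b₂ y ≈ 0#
  keepIf-⊗-disjoint b₁ b₂ x y disjoint = keepIf-⊗ false b₁ b₂ x y (λ ()) (λ p q → ⊥-elim (disjoint p q))

  keepIf-keepIf-disjoint : ∀ b₁ b₂ x → (T b₁ → T b₂ → ⊥) → keepIf b₁ (keepIf b₂ x) ≈ 0#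
  keepIf-keepIf-disjoint true  true  x disjoint = ⊥-elim (disjoint tt tt)
  keepIf-keepIf-disjoint true  false x _        = ≈-refl
  keepIf-keepIf-disjoint false b₂    x _        = ≈-refl

  Word : ℕ → Set
  Word n = List (Fin n)

  -- splitSum G w = Σ_{u ++ v = w} G u v
  splitSum : ∀ {n} → (Word n → Word n → Carrier) → Word n → Carrier
  splitSum G []      = G [] []
  splitSum G (x ∷ w) = G [] (x ∷ w) ⊕ splitSum (λ u v → G (x ∷ u) v) w

  mulP≈splitSum : ∀ {n} (f g : Poly n) w → mulP f g w ≈ splitSum (λ u v → f u ⊗ g v) w
  mulP≈splitSum f g []      = ≈-refl
  mulP≈splitSum f g (x ∷ w) = +-cong ≈-refl (mulP≈splitSum (λ u → f (x ∷ u)) g w)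

  splitSum-cong : ∀ {n} (G H : Word n → Word n → Carrier) w → (∀ u v → u ++ v ≡ w → G u v ≈ H u v) →
                  splitSum G w ≈ splitSum H w
  splitSum-cong G H []      G≈H = G≈H [] [] refl
  splitSum-cong G H (x ∷ w) G≈H =
    +-cong (G≈H [] (x ∷ w) refl) (splitSum-cong _ _ w (λ u v uv≡w → G≈H (x ∷ u) v (cong (x ∷_) uv≡w)))

  splitSum-⊕ : ∀ {n} (G H : Word n → Word n → Carrier) w →
               splitSum (λ u v → G u v ⊕ H u v) w ≈ splitSum G w ⊕ splitSum H w
  splitSum-⊕ G H []      = ≈-refl
  splitSum-⊕ G H (x ∷ w) = ≈-trans (+-cong ≈-refl (splitSum-⊕ _ _ w)) (interchange _ _ _ _)

  splitSum-≈0 : ∀ {n} (G : Word n → Word n → Carrier) w → (∀ u v → G u v ≈ 0#) → splitSum G w ≈ 0#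
  splitSum-≈0 G []      G≈0 = G≈0 [] []
  splitSum-≈0 G (x ∷ w) G≈0 = ⊕-≈0 (G≈0 [] (x ∷ w)) (splitSum-≈0 _ w (λ u v → G≈0 (x ∷ u) v))

  keepIf-splitSum : ∀ {n} b (G : Word n → Word n → Carrier) w →
                    keepIf b (splitSum G w) ≈ splitSum (λ u v → keepIf b (G u v)) w
  keepIf-splitSum true  G w = splitSum-cong _ _ w (λ _ _ _ → ≈-refl)
  keepIf-splitSum false G w = ≈-sym (splitSum-≈0 _ w (λ _ _ → ≈-refl))

  mulP-cong : ∀ {n} {f f′ g g′ : Poly n} → f ≋ f′ → g ≋ g′ → mulP f g ≋ mulP f′ g′
  mulP-cong {f = f} {f′} {g} {g′} f≋f′ g≋g′ w = begin
    mulP f g w                            ≈⟨ mulP≈splitSum f g w ⟩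
    splitSum (λ u v → f u ⊗ g v) w        ≈⟨ splitSum-cong _ _ w (λ u v _ → *-cong (f≋f′ u) (g≋g′ v)) ⟩
    splitSum (λ u v → f′ u ⊗ g′ v) w      ≈⟨ mulP≈splitSum f′ g′ w ⟨
    mulP f′ g′ w                          ∎

  rangeSum : (ℕ → Carrier) → ℕ → ℕ → Carrier
  rangeSum X c zero    = 0#
  rangeSum X c (suc t) = X c ⊕ rangeSum X (suc c) t

  rangeSum-≈0 : ∀ X c t → (∀ c′ → c ≤ c′ → c′ < c + t → X c′ ≈ 0#) → rangeSum X c t ≈ 0#
  rangeSum-≈0 X c zero    _   = ≈-refl
  rangeSum-≈0 X c (suc t) X≈0 =
    ⊕-≈0 (X≈0 c ℕₚ.≤-refl (ℕₚ.m<m+n c (s≤s z≤n)))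
         (rangeSum-≈0 X (suc c) t (λ c′ c<c′ c′<end →
            X≈0 c′ (ℕₚ.<⇒≤ c<c′) (subst (c′ <_) (sym (ℕₚ.+-suc c t)) c′<end)))

  rangeSum-single : ∀ X c t d → (∀ c′ → c′ ≢ d → X c′ ≈ 0#) → c ≤ d → d < c + t → rangeSum X c t ≈ X d
  rangeSum-single X c zero    d _   c≤d d<c+0 =
    ⊥-elim (ℕₚ.<-irrefl refl (ℕₚ.≤-<-trans c≤d (subst (d <_) (ℕₚ.+-identityʳ c) d<c+0)))
  rangeSum-single X c (suc t) d X≈0 c≤d d<end with ℕₚ.m≤n⇒m<n∨m≡n c≤d
  ... | inj₂ refl =
    ≈-trans (+-cong ≈-refl (rangeSum-≈0 X (suc c) t (λ c′ c<c′ _ → X≈0 c′ (ℕₚ.<⇒≢ c<c′ ∘′ sym))))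
            (+-identityʳ _)
  ... | inj₁ c<d  =
    ≈-trans (+-cong (X≈0 c (ℕₚ.<⇒≢ c<d))
                    (rangeSum-single X (suc c) t d X≈0 c<d (subst (d <_) (ℕₚ.+-suc c t) d<end)))
            (+-identityˡ _)

  rangeSum-cong : ∀ {X Y} c t → (∀ c′ → X c′ ≈ Y c′) → rangeSum X c t ≈ rangeSum Y c t
  rangeSum-cong c zero    X≈Y = ≈-refl
  rangeSum-cong c (suc t) X≈Y = +-cong (X≈Y c) (rangeSum-cong (suc c) t X≈Y)

  rangeSum-splitSum : ∀ {n} (G : ℕ → Word n → Word n → Carrier) c t w →
                      rangeSum (λ c′ → splitSum (G c′) w) c t ≈
                      splitSum (λ u v → rangeSum (λ c′ → G c′ u v) c t) w
  rangeSum-splitSum G c zero    w = ≈-sym (splitSum-≈0 _ w (λ _ _ → ≈-refl))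
  rangeSum-splitSum G c (suc t) w =
    ≈-trans (+-cong ≈-refl (rangeSum-splitSum G (suc c) t w)) (≈-sym (splitSum-⊕ _ _ w))

  sumP : ∀ {n} → (ℕ → Poly n) → ℕ → ℕ → Poly n
  sumP P c t w = rangeSum (λ c′ → P c′ w) c t

  module _ {n m : ℕ} (β : Fin n → Fin m) where
    open Buckets β
    open BucketWords β

    infixl 30 _[_,_⟩
    _[_,_⟩ : Poly n → ℕ → ℕ → Poly n
    g [ a , b ⟩ = restrict β a b g

    Restricted : ℕ → ℕ → Poly n → Set ℓ
    Restricted a b p = p ≋ p [ a , b ⟩

    restrict-⊕ : ∀ a b (p q : Poly n) → addP p q [ a , b ⟩ ≋ addP (p [ a , b ⟩) (q [ a , b ⟩)
    restrict-⊕ a b p q w = keepIf-⊕ (inRange a b w) (p w) (q w)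

    restricted-⊕ : ∀ {a b p q} → Restricted a b p → Restricted a b q → Restricted a b (addP p q)
    restricted-⊕ {a} {b} p∈ q∈ w = keepIf-absorbs (inRange a b w) _ (λ w∉ →
      ⊕-≈0 (≈-trans (p∈ w) (keepIf-false _ _ w∉)) (≈-trans (q∈ w) (keepIf-false _ _ w∉)))

    MulLabels-++ : ∀ {a b a₁ b₁ a₂ b₂} u v → MulLabels β (a , b) (a₁ , b₁) (a₂ , b₂) →
                   T (inRange a₁ b₁ u) → T (inRange a₂ b₂ v) → T (inRange a b (u ++ v))
    MulLabels-++ {a} u v (inj₁ (refl , refl , refl)) p q
      with inRange-empty a u p | inRange-empty a v q
    ... | refl | refl = inRange-[]⁺ a
    MulLabels-++ {b = b} u v (inj₂ (_ , inj₁ (refl , refl))) p q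
      with inRange-empty b v q
    ... | refl = subst (T ∘′ inRange _ b) (sym (++-identityʳ u)) p
    MulLabels-++ {a} u v (inj₂ (_ , inj₂ (inj₁ (refl , refl)))) p q
      with inRange-empty a u p
    ... | refl = q
    MulLabels-++ [] v (inj₂ (_ , inj₂ (inj₂ (c , a≤c , _ , refl , refl)))) p q =
      ⊥-elim (¬inRange-[] (s≤s a≤c) p)
    MulLabels-++ (x ∷ u) [] (inj₂ (_ , inj₂ (inj₂ (c , _ , c<b , refl , refl)))) p q =
      ⊥-elim (¬inRange-[] c<b q)
    MulLabels-++ {a} {b} (x ∷ u) (y ∷ v) (inj₂ (_ , inj₂ (inj₂ (c , _ , _ , refl , refl)))) p q =
      inRange-++⁺ a b c x u y v p q

    restricted-⊗ : ∀ {a b a₁ b₁ a₂ b₂ p q} → MulLabels β (a , b) (a₁ , b₁) (a₂ , b₂) →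
                   Restricted a₁ b₁ p → Restricted a₂ b₂ q → Restricted a b (mulP p q)
    restricted-⊗ {a} {b} {a₁} {b₁} {a₂} {b₂} {p} {q} labels p∈ q∈ w =
      keepIf-absorbs (inRange a b w) _ λ w∉ → begin
        mulP p q w                       ≈⟨ mulP≈splitSum p q w ⟩
        splitSum (λ u v → p u ⊗ q v) w   ≈⟨ splitSum-cong _ _ w (λ u v uv≡w →
                                              ≈-trans (*-cong (p∈ u) (q∈ v))
                                                (keepIf-⊗-disjoint (inRange a₁ b₁ u) (inRange a₂ b₂ v) _ _
                                                  (λ u∈ v∈ → w∉ (subst (T ∘′ inRange a b) uv≡w
                                                                   (MulLabels-++ u v labels u∈ v∈))))) ⟩
        splitSum (λ _ _ → 0#) w          ≈⟨ splitSum-≈0 _ w (λ _ _ → ≈-refl) ⟩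
        0#                               ∎

    restricted-const0 : ∀ a b → Restricted a b (constP 0#)
    restricted-const0 a b []      = ≈-sym (keepIf-0# _)
    restricted-const0 a b (_ ∷ _) = ≈-sym (keepIf-0# _)

    restricted-const : ∀ a k → Restricted a a (constP k)
    restricted-const a k []      = ≈-sym (keepIf-true (a ≡ᵇ a) k (inRange-[]⁺ a))
    restricted-const a k (_ ∷ _) = ≈-sym (keepIf-0# _)

    restrict-const-outside : ∀ {a b} k → a ≢ b → constP k [ a , b ⟩ ≋ zeroP
    restrict-const-outside {a} {b} k a≢b []      = keepIf-false (a ≡ᵇ b) k (a≢b ∘′ inRange-[]⁻)
    restrict-const-outside         k _   (_ ∷ _) = keepIf-0# _

    restricted-var : ∀ {a b} x → a < b → bkt x ≡ a → Restricted a b (varP x)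
    restricted-var x a<b x∈a []           = ≈-sym (keepIf-0# _)
    restricted-var {a} {b} x a<b x∈a (y ∷ []) =
      keepIf-absorbs (inRange a b (y ∷ [])) (varP x (y ∷ []))
        (λ y∉ → keepIf-false (toℕ x ≡ᵇ toℕ y) 1# (λ x≡y → y∉ (inside (toℕ-injective (ℕₚ.≡ᵇ⇒≡ _ _ x≡y)))))
      where
        inside : x ≡ y → T (inRange a b (y ∷ []))
        inside refl = inRange-∷⁺ x [] a<b x∈a tt tt
    restricted-var x a<b x∈a (_ ∷ _ ∷ _)  = ≈-sym (keepIf-0# _)

    restrict-var-outside : ∀ {a b} x → ¬ (a < b × bkt x ≡ a) → varP x [ a , b ⟩ ≋ zeroP
    restrict-var-outside x _ []               = keepIf-0# _
    restrict-var-outside {a} {b} x outside (y ∷ []) =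
      keepIf-keepIf-disjoint (inRange a b (y ∷ [])) (toℕ x ≡ᵇ toℕ y) 1#
        (λ y∈ x≡y → outside (inside y∈ (toℕ-injective (ℕₚ.≡ᵇ⇒≡ _ _ x≡y))))
      where
        inside : T (inRange a b (y ∷ [])) → x ≡ y → a < b × bkt x ≡ a
        inside y∈ refl = lower<upper x∈ , head≡lower x∈
          where x∈ : InRange∷ a b x []
                x∈ = inRange-∷⁻ x [] y∈
    restrict-var-outside x _ (_ ∷ _ ∷ _)      = keepIf-0# _

    restrict-mulP : ∀ a b (g h : Poly n) w →
                    (mulP g h [ a , b ⟩) w ≈ splitSum (λ u v → keepIf (inRange a b (u ++ v)) (g u ⊗ h v)) w
    restrict-mulP a b g h w = begin
      keepIf (inRange a b w) (mulP g h w)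
        ≈⟨ keepIf-cong (inRange a b w) (mulP≈splitSum g h w) ⟩
      keepIf (inRange a b w) (splitSum (λ u v → g u ⊗ h v) w)
        ≈⟨ keepIf-splitSum (inRange a b w) _ w ⟩
      splitSum (λ u v → keepIf (inRange a b w) (g u ⊗ h v)) w
        ≈⟨ splitSum-cong _ _ w (λ u v uv≡w →
             reflexive (cong (λ z → keepIf (inRange a b z) (g u ⊗ h v)) (sym uv≡w))) ⟩
      splitSum (λ u v → keepIf (inRange a b (u ++ v)) (g u ⊗ h v)) w ∎

    restrict-⊗-diagonal : ∀ a (g h : Poly n) → mulP g h [ a , a ⟩ ≋ mulP (g [ a , a ⟩) (h [ a , a ⟩)
    restrict-⊗-diagonal a g h w = begin
      (mulP g h [ a , a ⟩) w
        ≈⟨ restrict-mulP a a g h w ⟩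
      splitSum (λ u v → keepIf (inRange a a (u ++ v)) (g u ⊗ h v)) w
        ≈⟨ splitSum-cong _ _ w (λ u v _ → ≈-sym (keepIf-⊗ (inRange a a (u ++ v)) (inRange a a u) (inRange a a v) _ _
             (inRange-++-empty⁻ a u v) (MulLabels-++ u v (inj₁ (refl , refl , refl))))) ⟩
      splitSum (λ u v → keepIf (inRange a a u) (g u) ⊗ keepIf (inRange a a v) (h v)) w
        ≈⟨ mulP≈splitSum _ _ w ⟨
      mulP (g [ a , a ⟩) (h [ a , a ⟩) w ∎

    module ProductRestriction (g h : Poly n) {a b : ℕ} (a<b : a < b) where

      leftOnly rightOnly : Word n → Word n → Carrier
      leftOnly  u v = keepIf (inRange a b u) (g u) ⊗ keepIf (inRange b b v) (h v)
      rightOnly u v = keepIf (inRange a a u) (g u) ⊗ keepIf (inRange a b v) (h v)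

      cutAt : ℕ → Word n → Word n → Carrier
      cutAt c u v = keepIf (inRange a (suc c) u) (g u) ⊗ keepIf (inRange c b v) (h v)

      cuts : Word n → Word n → Carrier
      cuts u v = rangeSum (λ c → cutAt c u v) a (b ∸ a)

      a+[b∸a]≡b : a + (b ∸ a) ≡ b
      a+[b∸a]≡b = ℕₚ.m+[n∸m]≡n (ℕₚ.<⇒≤ a<b)

      split : ∀ u v → (leftOnly u v ⊕ rightOnly u v) ⊕ cuts u v ≈ keepIf (inRange a b (u ++ v)) (g u ⊗ h v)
      split [] [] =
        ⊕₃-only₃ (keepIf-⊗-disjoint (inRange a b []) (inRange b b []) _ _ (λ u∈ _ → ¬inRange-[] a<b u∈))
                 (keepIf-⊗-disjoint (inRange a a []) (inRange a b []) _ _ (λ _ v∈ → ¬inRange-[] a<b v∈))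
                 (≈-trans (rangeSum-≈0 _ a (b ∸ a) (λ c a≤c _ →
                            keepIf-⊗-disjoint (inRange a (suc c) []) (inRange c b []) _ _
                              (λ u∈ _ → ¬inRange-[] (s≤s a≤c) u∈)))
                          (≈-sym (keepIf-false (inRange a b []) _ (¬inRange-[] a<b))))
      split [] (y ∷ v) =
        ⊕₃-only₂ (keepIf-⊗-disjoint (inRange a b []) (inRange b b (y ∷ v)) _ _ (λ u∈ _ → ¬inRange-[] a<b u∈))
                 (keepIf-⊗ (inRange a b (y ∷ v)) (inRange a a []) (inRange a b (y ∷ v)) _ _
                   (λ v∈ → inRange-[]⁺ a , v∈) (λ _ v∈ → v∈))
                 (rangeSum-≈0 _ a (b ∸ a) (λ c a≤c _ →
                   keepIf-⊗-disjoint (inRange a (suc c) []) (inRange c b (y ∷ v)) _ _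
                     (λ u∈ _ → ¬inRange-[] (s≤s a≤c) u∈)))
      split (x ∷ u) [] rewrite ++-identityʳ u =
        ⊕₃-only₁ (keepIf-⊗ (inRange a b (x ∷ u)) (inRange a b (x ∷ u)) (inRange b b []) _ _
                   (λ u∈ → u∈ , inRange-[]⁺ b) (λ u∈ _ → u∈))
                 (keepIf-⊗-disjoint (inRange a a (x ∷ u)) (inRange a b []) _ _ (λ u∈ _ → inRange-∷-empty a x u u∈))
                 (rangeSum-≈0 _ a (b ∸ a) (λ c _ c<a+t →
                   keepIf-⊗-disjoint (inRange a (suc c) (x ∷ u)) (inRange c b []) _ _
                     (λ _ v∈ → ¬inRange-[] (subst (c <_) a+[b∸a]≡b c<a+t) v∈)))
      split (x ∷ u) (y ∷ v) =
        ⊕₃-only₃ (keepIf-⊗-disjoint (inRange a b (x ∷ u)) (inRange b b (y ∷ v)) _ _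
                   (λ _ v∈ → inRange-∷-empty b y v v∈))
                 (keepIf-⊗-disjoint (inRange a a (x ∷ u)) (inRange a b (y ∷ v)) _ _
                   (λ u∈ _ → inRange-∷-empty a x u u∈))
                 (cuts-∷ x u y v)
        where
          cuts-∷ : ∀ x u y v →
                   cuts (x ∷ u) (y ∷ v) ≈ keepIf (inRange a b (x ∷ u ++ y ∷ v)) (g (x ∷ u) ⊗ h (y ∷ v))
          cuts-∷ x u y v with T? (inRange a b (x ∷ u ++ y ∷ v))
          ... | yes uv∈ =
            ≈-trans (rangeSum-single _ a (b ∸ a) (bkt y) cut-elsewhere≈0 a≤y
                       (subst (bkt y <_) (sym a+[b∸a]≡b) y<b))
                    (keepIf-⊗ (inRange a b (x ∷ u ++ y ∷ v))
                              (inRange a (suc (bkt y)) (x ∷ u)) (inRange (bkt y) b (y ∷ v)) _ _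
                              (inRange-++⁻ a b x u y v) (inRange-++⁺ a b (bkt y) x u y v))
            where
              halves : T (inRange a (suc (bkt y)) (x ∷ u)) × T (inRange (bkt y) b (y ∷ v))
              halves = inRange-++⁻ a b x u y v uv∈
              a≤y : a ≤ bkt y
              a≤y = ℕₚ.m<1+n⇒m≤n (lower<upper (inRange-∷⁻ {a} x u (proj₁ halves)))
              y<b : bkt y < b
              y<b = lower<upper (inRange-∷⁻ {bkt y} {b} y v (proj₂ halves))
              cut-elsewhere≈0 : ∀ c → c ≢ bkt y → cutAt c (x ∷ u) (y ∷ v) ≈ 0#
              cut-elsewhere≈0 c c≢y = keepIf-⊗-disjoint (inRange a (suc c) (x ∷ u)) (inRange c b (y ∷ v)) _ _
                (λ _ v∈ → c≢y (sym (head≡lower (inRange-∷⁻ {c} {b} y v v∈))))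
          ... | no uv∉ =
            ≈-trans (rangeSum-≈0 _ a (b ∸ a) (λ c _ _ →
                       keepIf-⊗-disjoint (inRange a (suc c) (x ∷ u)) (inRange c b (y ∷ v)) _ _
                         (λ u∈ v∈ → uv∉ (inRange-++⁺ a b c x u y v u∈ v∈))))
                    (≈-sym (keepIf-false _ _ uv∉))

      restrict-⊗-decomposition :
        mulP g h [ a , b ⟩ ≋
          addP (addP (mulP (g [ a , b ⟩) (h [ b , b ⟩)) (mulP (g [ a , a ⟩) (h [ a , b ⟩)))
               (sumP (λ c → mulP (g [ a , suc c ⟩) (h [ c , b ⟩)) a (b ∸ a))
      restrict-⊗-decomposition w = begin
        (mulP g h [ a , b ⟩) w
          ≈⟨ restrict-mulP a b g h w ⟩
        splitSum (λ u v → keepIf (inRange a b (u ++ v)) (g u ⊗ h v)) w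
          ≈⟨ splitSum-cong _ _ w (λ u v _ → ≈-sym (split u v)) ⟩
        splitSum (λ u v → (leftOnly u v ⊕ rightOnly u v) ⊕ cuts u v) w
          ≈⟨ ≈-trans (splitSum-⊕ _ _ w)
                     (+-cong (splitSum-⊕ _ _ w) (≈-sym (rangeSum-splitSum cutAt a (b ∸ a) w))) ⟩
        (splitSum leftOnly w ⊕ splitSum rightOnly w) ⊕ rangeSum (λ c → splitSum (cutAt c) w) a (b ∸ a)
          ≈⟨ +-cong (+-cong (≈-sym (mulP≈splitSum _ _ w)) (≈-sym (mulP≈splitSum _ _ w)))
                    (rangeSum-cong a (b ∸ a) (λ c → ≈-sym (mulP≈splitSum _ _ w))) ⟩
        addP (addP (mulP (g [ a , b ⟩) (h [ b , b ⟩)) (mulP (g [ a , a ⟩) (h [ a , b ⟩)))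
             (sumP (λ c → mulP (g [ a , suc c ⟩) (h [ c , b ⟩)) a (b ∸ a)) w
          ∎

    open ProductRestriction using (restrict-⊗-decomposition)

    abecedarian-reconstruction : ∀ f → Abecedarian β f → ∀ w → rangeSum (λ a → (f [ a , m ⟩) w) 0 (suc m) ≈ f w
    abecedarian-reconstruction f _ [] =
      ≈-trans (rangeSum-single _ 0 (suc m) m
                 (λ a a≢m → keepIf-false (a ≡ᵇ m) _ (a≢m ∘′ inRange-[]⁻)) z≤n ℕₚ.≤-refl)
              (keepIf-true (m ≡ᵇ m) _ (inRange-[]⁺ m))
    abecedarian-reconstruction f abecedarian (y ∷ ys) with T? (sortedFrom (bkt y) ys)
    ... | yes ys-sorted =
      ≈-trans (rangeSum-single _ 0 (suc m) (bkt y)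
                 (λ a a≢y → keepIf-false (inRange a m (y ∷ ys)) _
                              (λ y∈ → a≢y (sym (head≡lower (inRange-∷⁻ {a} {m} y ys y∈)))))
                 z≤n (s≤s (ℕₚ.<⇒≤ (toℕ<n (β y)))))
              (keepIf-true _ _ (inRange-∷⁺ y ys (toℕ<n (β y)) refl ys-sorted (allBelow-bucketCount ys)))
    ... | no ys-unsorted =
      ≈-trans (rangeSum-≈0 _ 0 (suc m) (λ a _ _ → keepIf-false (inRange a m (y ∷ ys)) _
                 (λ y∈ → ys-unsorted (tail-sorted (inRange-∷⁻ {a} {m} y ys y∈)))))
              (≈-sym (abecedarian y ys (¬T⇒≡false (ys-unsorted ∘′ proj₂ ∘′ sortedFrom-∷⁻ 0 y ys))))

    record Partial : Set (c ⊔ ℓ) where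
      constructor partial
      field
        size        : ℕ
        circuit     : Circuit n size
        labels      : Fin size → Label β
        abecedarian : IsAbecedarian β circuit labels

    open Partial

    GateFor : Partial → ℕ → ℕ → Poly n → Set ℓ
    GateFor s a b p = Σ (Fin (size s)) λ r → labels s r ≡ (a , b) × eval (circuit s) r ≋ p

    GateFor-≋ : ∀ {s a b p q} → GateFor s a b p → p ≋ q → GateFor s a b q
    GateFor-≋ (r , r∈ , r≋p) p≋q = r , r∈ , λ w → ≈-trans (r≋p w) (p≋q w)

    gate-restricted : ∀ s r {a b} → labels s r ≡ (a , b) → Restricted a b (eval (circuit s) r)
    gate-restricted s r r∈ with labels s r | r∈ | proj₁ (proj₂ (abecedarian s r))
    ... | _ | refl | restricted = restricted

    record _≼_ (s s′ : Partial) : Set ℓ where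
      field
        embed       : Fin (size s) → Fin (size s′)
        embed-label : ∀ r → labels s′ (embed r) ≡ labels s r
        embed-eval  : ∀ r → eval (circuit s′) (embed r) ≋ eval (circuit s) r

    open _≼_

    ≼-refl : ∀ s → s ≼ s
    ≼-refl s = record { embed = λ r → r ; embed-label = λ _ → refl ; embed-eval = λ _ _ → ≈-refl }

    ≼-trans : ∀ {s₁ s₂ s₃} → s₁ ≼ s₂ → s₂ ≼ s₃ → s₁ ≼ s₃
    ≼-trans e₁ e₂ = record
      { embed       = λ r → embed e₂ (embed e₁ r)
      ; embed-label = λ r → ≡-trans (embed-label e₂ (embed e₁ r)) (embed-label e₁ r)
      ; embed-eval  = λ r w → ≈-trans (embed-eval e₂ (embed e₁ r) w) (embed-eval e₁ r w)
      }

    GateFor-≼ : ∀ {s s′ a b p} → s ≼ s′ → GateFor s a b p → GateFor s′ a b p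
    GateFor-≼ e (r , r∈ , r≋p) =
      embed e r , ≡-trans (embed-label e r) r∈ , λ w → ≈-trans (embed-eval e r w) (r≋p w)

    Build : ℕ → (Partial → Set ℓ) → Partial → Set (c ⊔ ℓ)
    Build j X s = Σ Partial λ s′ → s ≼ s′ × size s′ ≤ j + size s × X s′

    return : ∀ {X s} → X s → Build 0 X s
    return {s = s} x = s , ≼-refl s , ℕₚ.≤-refl , x

    bind : ∀ {j j′ X Y s} → Build j X s → (∀ s′ → s ≼ s′ → X s′ → Build j′ Y s′) →
           Build (j′ + j) Y s
    bind {j} {j′} {s = s} (s₁ , e₁ , size₁ , x) k with k s₁ e₁ x
    ... | s₂ , e₂ , size₂ , y =
      s₂ , ≼-trans e₁ e₂ ,
      ℕₚ.≤-trans size₂ (ℕₚ.≤-trans (ℕₚ.+-monoʳ-≤ j′ size₁)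
                                   (ℕₚ.≤-reflexive (sym (ℕₚ.+-assoc j′ j (size s))))) ,
      y

    relax : ∀ {j j′ X s} → j ≤ j′ → Build j X s → Build j′ X s
    relax j≤j′ (s′ , e , size′ , x) = s′ , e , ℕₚ.≤-trans size′ (ℕₚ.+-monoˡ-≤ _ j≤j′) , x

    mapBuild : ∀ {j X Y s} → (∀ {s′} → X s′ → Y s′) → Build j X s → Build j Y s
    mapBuild f (s′ , e , size′ , x) = s′ , e , size′ , f x

    forEach : (X : ℕ → Partial → Set ℓ) → (∀ x {s s′} → s ≼ s′ → X x s → X x s′) →
              ∀ j s₀ → (∀ x s → s₀ ≼ s → Build j (X x) s) →
              ∀ t → Build (t * j) (λ s′ → ∀ x → x < t → X x s′) s₀
    forEach X X-≼ j s₀ step zero    = return {X = λ s′ → ∀ x → x < zero → X x s′} (λ _ ())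
    forEach X X-≼ j s₀ step (suc t) =
      bind {X = λ s′ → ∀ x → x < t → X x s′} {Y = λ s′ → ∀ x → x < suc t → X x s′}
        (forEach X X-≼ j s₀ step t) (λ s₁ e₁ earlier →
        bind {X = X t} {Y = λ s′ → ∀ x → x < suc t → X x s′} (step t s₁ e₁) (λ s₂ e₂ last →
        return {X = λ s′ → ∀ x → x < suc t → X x s′} (combine e₂ earlier last)))
      where
        combine : ∀ {s₁ s₂} → s₁ ≼ s₂ → (∀ x → x < t → X x s₁) → X t s₂ → ∀ x → x < suc t → X x s₂
        combine e₂ earlier last x x<1+t with ℕₚ.m<1+n⇒m<n∨m≡n x<1+t
        ... | inj₁ x<t  = X-≼ x e₂ (earlier x x<t)
        ... | inj₂ refl = last

    GateOK-extend : ∀ {j k} (lab : Fin k → Label β) l′ l (g : Gate n j) (emb : Fin j → Fin k) →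
                    GateOK β lab l g emb → GateOK β (l′ VF.∷ lab) l g (fsuc ∘′ emb)
    GateOK-extend lab l′ l (var x)   emb ok = ok
    GateOK-extend lab l′ l (const x) emb ok = ok
    GateOK-extend lab l′ l (add i j) emb ok = ok
    GateOK-extend lab l′ l (mul i j) emb ok = ok

    IsAbecedarian-∷ : ∀ {k} (C : Circuit n k) lab (g : Gate n k) {a b} → IsAbecedarian β C lab →
                      ValidLabel β (a , b) → Restricted a b (gateP g (eval C)) → GateOK β lab (a , b) g id →
                      IsAbecedarian β (g ∷ C) ((a , b) VF.∷ lab)
    IsAbecedarian-∷ C lab g {a} {b} _  valid restricted ok fzero =
      valid , restricted , GateOK-extend lab (a , b) (a , b) g id ok
    IsAbecedarian-∷ C lab g {a} {b} abc _ _ _ (fsuc i) with gateAt C i | abc i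
    ... | _ , g′ , emb | valid′ , restricted′ , ok′ =
      valid′ , restricted′ , GateOK-extend lab (a , b) (lab i) g′ emb ok′

    emit : ∀ s (g : Gate n (size s)) {a b} → ValidLabel β (a , b) → Restricted a b (gateP g (eval (circuit s))) →
           GateOK β (labels s) (a , b) g id → Build 1 (λ s′ → GateFor s′ a b (gateP g (eval (circuit s)))) s
    emit (partial k C lab abc) g {a} {b} valid restricted ok =
      partial (suc k) (g ∷ C) ((a , b) VF.∷ lab) (IsAbecedarian-∷ C lab g abc valid restricted ok) ,
      record { embed = fsuc ; embed-label = λ _ → refl ; embed-eval = λ _ _ → ≈-refl } ,
      ℕₚ.≤-refl , (fzero , refl , λ _ → ≈-refl)

    emitZero : ∀ s {a b p} → ValidLabel β (a , b) → p ≋ zeroP → Build 1 (λ s′ → GateFor s′ a b p) s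
    emitZero s {a} {b} valid p≋0 =
      mapBuild (λ {s′} r → GateFor-≋ {s′} r (λ w → ≈-trans (const0≈0 w) (≈-sym (p≋0 w))))
        (emit s (const 0#) valid (restricted-const0 a b) tt)
      where
        const0≈0 : ∀ w → constP {n} 0# w ≈ 0#
        const0≈0 []      = ≈-refl
        const0≈0 (_ ∷ _) = ≈-refl

    emitAdd : ∀ s {a b p q} → ValidLabel β (a , b) → GateFor s a b p → GateFor s a b q →
              Build 1 (λ s′ → GateFor s′ a b (addP p q)) s
    emitAdd s valid (r₁ , r₁∈ , r₁≋p) (r₂ , r₂∈ , r₂≋q) =
      mapBuild (λ {s′} r → GateFor-≋ {s′} r (λ w → +-cong (r₁≋p w) (r₂≋q w)))
        (emit s (add r₁ r₂) valid (restricted-⊕ (gate-restricted s r₁ r₁∈) (gate-restricted s r₂ r₂∈))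
          (r₁∈ , r₂∈))

    emitMul : ∀ s {a b a₁ b₁ a₂ b₂ p q} → ValidLabel β (a , b) → MulLabels β (a , b) (a₁ , b₁) (a₂ , b₂) →
              GateFor s a₁ b₁ p → GateFor s a₂ b₂ q → Build 1 (λ s′ → GateFor s′ a b (mulP p q)) s
    emitMul s {a} {b} valid shape (r₁ , r₁∈ , r₁≋p) (r₂ , r₂∈ , r₂≋q) =
      mapBuild (λ {s′} r → GateFor-≋ {s′} r (mulP-cong r₁≋p r₂≋q))
        (emit s (mul r₁ r₂) valid (restricted-⊗ shape (gate-restricted s r₁ r₁∈) (gate-restricted s r₂ r₂∈))
          (subst₂ (MulLabels β (a , b)) (sym r₁∈) (sym r₂∈) shape))

    module Construction {s₀ : ℕ} (C₀ : Circuit n s₀) where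

      Table : Partial → Set ℓ
      Table s = ∀ i a b → a ≤ b → b ≤ m → GateFor s a b (eval C₀ i [ a , b ⟩)

      Table-≼ : ∀ {s s′} → s ≼ s′ → Table s → Table s′
      Table-≼ e T i a b a≤b b≤m = GateFor-≼ e (T i a b a≤b b≤m)

      module _ (i j : Fin s₀) {a b : ℕ} (a<b : a < b) (b≤m : b ≤ m) where

        valid : ValidLabel β (a , b)
        valid = ℕₚ.<⇒≤ a<b , b≤m

        cutsFrom : ℕ → ℕ → Poly n
        cutsFrom = sumP (λ c → mulP (eval C₀ i [ a , suc c ⟩) (eval C₀ j [ c , b ⟩))

        emitCuts : ∀ s → Table s → ∀ c t → a ≤ c → c + t ≡ b →
                   Build (cutCost t) (λ s′ → GateFor s′ a b (cutsFrom c t)) s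
        emitCuts s T c zero    _   _       = emitZero s valid (λ _ → ≈-refl)
        emitCuts s T c (suc t) a≤c c+t≡b =
          bind (emitCuts s T (suc c) t (ℕₚ.m≤n⇒m≤1+n a≤c) (≡-trans (sym (ℕₚ.+-suc c t)) c+t≡b))
            λ s₁ e₁ rest →
          bind (emitMul s₁ valid (inj₂ (a<b , inj₂ (inj₂ (c , a≤c , c<b , refl , refl))))
                  (Table-≼ e₁ T i a (suc c) (ℕₚ.m≤n⇒m≤1+n a≤c) (ℕₚ.≤-trans c<b b≤m))
                  (Table-≼ e₁ T j c b (ℕₚ.<⇒≤ c<b) b≤m)) λ s₂ e₂ cut →
          emitAdd s₂ valid cut (GateFor-≼ e₂ rest)
          where
            c<b : c < b
            c<b = subst (c <_) c+t≡b (ℕₚ.m<m+n c (s≤s z≤n))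

        emitProduct : ∀ s → Table s →
                      Build (4 + cutCost (b ∸ a)) (λ s′ → GateFor s′ a b (mulP (eval C₀ i) (eval C₀ j) [ a , b ⟩)) s
        emitProduct s T =
          mapBuild (λ {s′} r → GateFor-≋ {s′} r
                     (λ w → ≈-sym (restrict-⊗-decomposition (eval C₀ i) (eval C₀ j) a<b w)))
            (bind (emitCuts s T a (b ∸ a) ℕₚ.≤-refl (ℕₚ.m+[n∸m]≡n (ℕₚ.<⇒≤ a<b))) λ s₁ e₁ cuts →
             bind (emitMul s₁ valid (inj₂ (a<b , inj₁ (refl , refl)))
                     (Table-≼ e₁ T i a b (ℕₚ.<⇒≤ a<b) b≤m) (Table-≼ e₁ T j b b ℕₚ.≤-refl b≤m))
               λ s₂ e₂ leftOnly →
             bind (emitMul s₂ valid (inj₂ (a<b , inj₂ (inj₁ (refl , refl))))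
                     (Table-≼ (≼-trans e₁ e₂) T i a a ℕₚ.≤-refl (ℕₚ.≤-trans (ℕₚ.<⇒≤ a<b) b≤m))
                     (Table-≼ (≼-trans e₁ e₂) T j a b (ℕₚ.<⇒≤ a<b) b≤m)) λ s₃ e₃ rightOnly →
             bind (emitAdd s₃ valid (GateFor-≼ e₃ leftOnly) rightOnly) λ s₄ e₄ ends →
             emitAdd s₄ valid ends (GateFor-≼ (≼-trans e₂ (≼-trans e₃ e₄)) cuts))

      oneGateStep : ∀ {s a b p q} → Build 1 (λ s′ → GateFor s′ a b p) s → p ≋ q →
                    Build (pairCost m) (λ s′ → GateFor s′ a b q) s
      oneGateStep build p≋q = relax (s≤s z≤n) (mapBuild (λ {s′} r → GateFor-≋ {s′} r p≋q) build)

      emitGate : ∀ s → Table s → (g : Gate n s₀) → ∀ a b → a ≤ b → b ≤ m →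
                 Build (pairCost m) (λ s′ → GateFor s′ a b (gateP g (eval C₀) [ a , b ⟩)) s
      emitGate s T (var x) a b a≤b b≤m with a ℕₚ.<? b | bkt x ℕₚ.≟ a
      ... | yes a<b | yes x∈a =
        oneGateStep (emit s (var x) (a≤b , b≤m) (restricted-var x a<b x∈a) tt) (restricted-var x a<b x∈a)
      ... | no a≮b  | _       =
        oneGateStep (emitZero s (a≤b , b≤m) (restrict-var-outside x (a≮b ∘′ proj₁))) (λ _ → ≈-refl)
      ... | yes _   | no x∉a  =
        oneGateStep (emitZero s (a≤b , b≤m) (restrict-var-outside x (x∉a ∘′ proj₂))) (λ _ → ≈-refl)
      emitGate s T (const k) a b a≤b b≤m with a ℕₚ.≟ b
      ... | yes refl = oneGateStep (emit s (const k) (a≤b , b≤m) (restricted-const a k) tt) (restricted-const a k)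
      ... | no a≢b   = oneGateStep (emitZero s (a≤b , b≤m) (restrict-const-outside k a≢b)) (λ _ → ≈-refl)
      emitGate s T (add i j) a b a≤b b≤m =
        oneGateStep (emitAdd s (a≤b , b≤m) (T i a b a≤b b≤m) (T j a b a≤b b≤m))
                    (λ w → ≈-sym (restrict-⊕ a b (eval C₀ i) (eval C₀ j) w))
      emitGate s T (mul i j) a b a≤b b≤m with a ℕₚ.≟ b
      ... | yes refl =
        oneGateStep (emitMul s (a≤b , b≤m) (inj₁ (refl , refl , refl)) (T i a a a≤b b≤m) (T j a a a≤b b≤m))
                    (λ w → ≈-sym (restrict-⊗-diagonal a (eval C₀ i) (eval C₀ j) w))
      ... | no a≢b   =
        relax (ℕₚ.+-monoʳ-≤ 4 (cutCost-mono (ℕₚ.≤-trans (ℕₚ.m∸n≤m b a) b≤m)))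
              (emitProduct i j (ℕₚ.≤∧≢⇒< a≤b a≢b) b≤m s T)

      PairResult : Gate n s₀ → ℕ → ℕ → Partial → Set ℓ
      PairResult g a b s′ = a ≤ b → b ≤ m → GateFor s′ a b (gateP g (eval C₀) [ a , b ⟩)

      emitPair : ∀ s → Table s → (g : Gate n s₀) → ∀ a b → Build (pairCost m) (PairResult g a b) s
      emitPair s T g a b with a ℕₚ.≤? b | b ℕₚ.≤? m
      ... | yes a≤b | yes b≤m = mapBuild (λ r _ _ → r) (emitGate s T g a b a≤b b≤m)
      ... | no a≰b  | _       = relax z≤n (return {X = PairResult g a b} (λ a≤b _ → ⊥-elim (a≰b a≤b)))
      ... | yes _   | no b≰m  = relax z≤n (return {X = PairResult g a b} (λ _ b≤m → ⊥-elim (b≰m b≤m)))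

      GateResult : Gate n s₀ → Partial → Set ℓ
      GateResult g s′ = ∀ a b → a ≤ b → b ≤ m → GateFor s′ a b (gateP g (eval C₀) [ a , b ⟩)

      emitAllPairs : ∀ s → Table s → (g : Gate n s₀) → Build (gateCost m) (GateResult g) s
      emitAllPairs s T g =
        mapBuild (λ R a b a≤b b≤m → R a (s≤s (ℕₚ.≤-trans a≤b b≤m)) b (s≤s b≤m) a≤b b≤m)
          (forEach (λ a s′ → ∀ b → b < suc m → PairResult g a b s′)
                   (λ a e R b b<1+m a≤b b≤m → GateFor-≼ e (R b b<1+m a≤b b≤m))
                   (suc m * pairCost m) s
                   (λ a s₁ e₁ → forEach (PairResult g a) (λ b e R a≤b b≤m → GateFor-≼ e (R a≤b b≤m))
                                  (pairCost m) s₁ (λ b s₂ e₂ → emitPair s₂ (Table-≼ (≼-trans e₁ e₂) T) g a b)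
                                  (suc m))
                   (suc m))

    open Construction using (Table; emitAllPairs)

    Tabulated : ∀ {s₀} → Circuit n s₀ → Set (c ⊔ ℓ)
    Tabulated {s₀} C₀ = Σ Partial λ s → Table C₀ s × size s ≤ s₀ * gateCost m

    tabulate-∷ : ∀ {s₀} (g : Gate n s₀) (C₀ : Circuit n s₀) → Tabulated C₀ → Tabulated (g ∷ C₀)
    tabulate-∷ g C₀ (s , T , size≤) = extend (emitAllPairs C₀ s T g)
      where
        extend : Build (gateCost m) (Construction.GateResult C₀ g) s → Tabulated (g ∷ C₀)
        extend (s′ , e , size′≤ , R) = s′ , T′ , ℕₚ.≤-trans size′≤ (ℕₚ.+-monoʳ-≤ (gateCost m) size≤)
          where
            T′ : Table (g ∷ C₀) s′
            T′ fzero    = R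
            T′ (fsuc i) a b a≤b b≤m = GateFor-≼ e (T i a b a≤b b≤m)

    tabulate : ∀ {s₀} (C₀ : Circuit n s₀) → Tabulated C₀
    tabulate []       = partial 0 [] (λ ()) (λ ()) , (λ ()) , z≤n
    tabulate (g ∷ C₀) = tabulate-∷ g C₀ (tabulate C₀)

    AbecedarianCircuitFor : Poly n → ℕ → Set (c ⊔ ℓ)
    AbecedarianCircuitFor f bound =
      Σ ℕ λ s′ → Σ (Circuit n s′) λ C′ → Σ (Fin s′ → Label β) λ lab → Σ (List (Fin s′)) λ outs →
        IsAbecedarian β C′ lab × (sumOutputs C′ outs ≋ f) × (s′ ≤ bound)

    AbecedarianCircuitFor-mono : ∀ {f bound bound′} → bound ≤ bound′ →
                                 AbecedarianCircuitFor f bound → AbecedarianCircuitFor f bound′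
    AbecedarianCircuitFor-mono ≤bound′ (s′ , C′ , lab , outs , C′-abc , C′≋f , s′≤) =
      s′ , C′ , lab , outs , C′-abc , C′≋f , ℕₚ.≤-trans s′≤ ≤bound′

    abecedarianCircuit : ∀ {s} (f : Poly n) → Abecedarian β f → (C : Circuit n s) (o : Fin s) → Computes C o f →
                         AbecedarianCircuitFor f (s * gateCost m)
    abecedarianCircuit {s} f f-abc C o C≋f = fromTable (tabulate C)
      where
        fromTable : Tabulated C → AbecedarianCircuitFor f (s * gateCost m)
        fromTable (S , T , size≤) =
          size S , circuit S , labels S , outputs 0 (suc m) refl , abecedarian S ,
          (λ w → begin
            sumOutputs (circuit S) (outputs 0 (suc m) refl) w
              ≈⟨ sumOutputs-outputs 0 (suc m) refl w ⟩
            rangeSum (λ a → (eval C o [ a , m ⟩) w) 0 (suc m)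
              ≈⟨ rangeSum-cong 0 (suc m) (λ a → keepIf-cong (inRange a m w) (C≋f w)) ⟩
            rangeSum (λ a → (f [ a , m ⟩) w) 0 (suc m)
              ≈⟨ abecedarian-reconstruction f f-abc w ⟩
            f w ∎) ,
          size≤
          where
            a≤m : ∀ a t → a + suc t ≡ suc m → a ≤ m
            a≤m a t e = ℕₚ.m<1+n⇒m≤n (subst (a <_) e (ℕₚ.m<m+n a (s≤s z≤n)))

            outputs : ∀ a t → a + t ≡ suc m → List (Fin (size S))
            outputs a zero    _ = []
            outputs a (suc t) e =
              proj₁ (T o a m (a≤m a t e) ℕₚ.≤-refl) ∷ outputs (suc a) t (≡-trans (sym (ℕₚ.+-suc a t)) e)

            sumOutputs-outputs : ∀ a t e w →
              sumOutputs (circuit S) (outputs a t e) w ≈ rangeSum (λ a′ → (eval C o [ a′ , m ⟩) w) a t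
            sumOutputs-outputs a zero    _ w = ≈-refl
            sumOutputs-outputs a (suc t) e w =
              +-cong (proj₂ (proj₂ (T o a m (a≤m a t e) ℕₚ.≤-refl)) w)
                     (sumOutputs-outputs (suc a) t (≡-trans (sym (ℕₚ.+-suc a t)) e) w)

mainTheorem7 : ∀ {c ℓ} (F : Field c ℓ) → let open NC F in
    Σ ℕ λ K →
      ∀ {n m s : ℕ} (β : Fin n → Fin m) → 1 ≤ m →
      (f : Poly n) → Abecedarian β f →
      (C : Circuit n s) (o : Fin s) → Computes C o f →
      Σ ℕ λ s′ → Σ (Circuit n s′) λ C′ →
        Σ (Fin s′ → Label β) λ lab → Σ (List (Fin s′)) λ outs →
          IsAbecedarian β C′ lab × (sumOutputs C′ outs ≋ f) × (s′ ≤ K * (m ^ 3) * s)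
mainTheorem7 F = 28 , λ {_} {m} {s} β 1≤m f f-abc C o C≋f →
  AbecedarianCircuitFor-mono F β
    (ℕₚ.≤-trans (ℕₚ.*-monoʳ-≤ s (gateCost-bound 1≤m)) (ℕₚ.≤-reflexive (ℕₚ.*-comm s (28 * m ^ 3))))
    (abecedarianCircuit F β f f-abc C o C≋f)
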